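{- Let $(A,\le,\bullet,i,\multimap)$ be a poset with a residuated commutative pomonoid and all binary meets, let $k\in A$, and let $(\lhd,j)$ be a pomonoid on $(A,\le)$ such that $(\bullet,i)$ is duoidal over $(\lhd,j)$, $k\lhd k\le k$ and $j\le k$. Then on $\mathrm{Chu}(A,k)$, the pomonoid $(\otimes,I)$ is duoidal over the pomonoid $(\lhd,J)$.
   Context: A pomonoid is a monoid on a poset with monotone operation; a commutative pomonoid $(\bullet,i)$ is residuated if $x\bullet y\le z$ iff $x\le y\multimap z$. $(\bullet,i)$ is duoidal over $(\lhd,j)$ if $(w\lhd x)\bullet(y\lhd z)\le(w\bullet y)\lhd(x\bullet z)$, $j\bullet j\le j$, $i\le i\lhd i$, $i\le j$. $\mathrm{Chu}(A,k)$ is the poset of pairs $(a^+,a^-)\in A^2$ with $a^+\bullet a^-\le k$, ordered by $(a^+,a^-)\sqsubseteq(b^+,b^-)$ iff $a^+\le b^+$ and $b^-\le a^-$, with $(a^+,a^-)\otimes(b^+,b^-)=(a^+\bullet b^+,(b^+\multimap a^-)\wedge(a^+\multimap b^-))$, $I=(i,k)$, $(a^+,a^-)\lhd(b^+,b^-)=(a^+\lhd b^+,a^-\lhd b^-)$, $J=(j,j)$. -}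

module Defs where

open import Level using (Level; _⊔_; suc)
open import Data.Product using (Σ; _×_; _,_; proj₁; proj₂)
open import Relation.Binary.PropositionalEquality using (_≡_)

private variable a ℓ : Level

record IsPomonoid {A : Set a} (_≤_ : A → A → Set ℓ) (_·_ : A → A → A) (e : A) : Set (a ⊔ ℓ) where
  field
    assoc     : ∀ x y z → (x · y) · z ≡ x · (y · z)
    identityˡ : ∀ x → e · x ≡ x
    identityʳ : ∀ x → x · e ≡ x
    mono      : ∀ {x x′ y y′} → x ≤ x′ → y ≤ y′ → (x · y) ≤ (x′ · y′)

IsCommutative : {A : Set a} → (A → A → A) → Set a
IsCommutative _·_ = ∀ x y → x · y ≡ y · x

record IsResiduated {A : Set a} (_≤_ : A → A → Set ℓ) (_·_ : A → A → A) (_⊸_ : A → A → A) : Set (a ⊔ ℓ) where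
  field
    curry   : ∀ {x y z} → (x · y) ≤ z → x ≤ (y ⊸ z)
    uncurry : ∀ {x y z} → x ≤ (y ⊸ z) → (x · y) ≤ z

record IsMeet {A : Set a} (_≤_ : A → A → Set ℓ) (_∧_ : A → A → A) : Set (a ⊔ ℓ) where
  field
    lowerˡ   : ∀ x y → (x ∧ y) ≤ x
    lowerʳ   : ∀ x y → (x ∧ y) ≤ y
    greatest : ∀ {x y z} → z ≤ x → z ≤ y → z ≤ (x ∧ y)

record IsDuoidal {A : Set a} (_≤_ : A → A → Set ℓ)
                 (_·_ : A → A → A) (i : A) (_◁_ : A → A → A) (j : A) : Set (a ⊔ ℓ) where
  field
    interchange : ∀ w x y z → ((w ◁ x) · (y ◁ z)) ≤ ((w · y) ◁ (x · z))
    j·j≤j       : (j · j) ≤ j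
    i≤i◁i       : i ≤ (i ◁ i)
    i≤j         : i ≤ j

module ChuConstruction {A : Set a} (_≤_ : A → A → Set ℓ)
                       (_•_ : A → A → A) (_⊸_ : A → A → A) (_∧_ : A → A → A)
                       (i k : A) (_◁_ : A → A → A) (j : A) where

  Pair : Set a
  Pair = A × A

  InChu : Pair → Set ℓ
  InChu (p , n) = (p • n) ≤ k

  Chu : Set (a ⊔ ℓ)
  Chu = Σ Pair InChu

  _⊑_ : Chu → Chu → Set ℓ
  ((a⁺ , a⁻) , _) ⊑ ((b⁺ , b⁻) , _) = (a⁺ ≤ b⁺) × (b⁻ ≤ a⁻)

  _⊗ᵖ_ : Pair → Pair → Pair
  (a⁺ , a⁻) ⊗ᵖ (b⁺ , b⁻) = (a⁺ • b⁺ , ((b⁺ ⊸ a⁻) ∧ (a⁺ ⊸ b⁻)))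

  Iᵖ : Pair
  Iᵖ = (i , k)

  _◁ᵖ_ : Pair → Pair → Pair
  (a⁺ , a⁻) ◁ᵖ (b⁺ , b⁻) = (a⁺ ◁ b⁺ , a⁻ ◁ b⁻)

  Jᵖ : Pair
  Jᵖ = (j , j)

  module OnChu (⊗-closed : ∀ x y → InChu x → InChu y → InChu (x ⊗ᵖ y))
               (I-in : InChu Iᵖ)
               (◁-closed : ∀ x y → InChu x → InChu y → InChu (x ◁ᵖ y))
               (J-in : InChu Jᵖ) where

    _⊗_ : Chu → Chu → Chu
    (x , px) ⊗ (y , py) = (x ⊗ᵖ y , ⊗-closed x y px py)

    I : Chu
    I = (Iᵖ , I-in)

    _◁ᶜ_ : Chu → Chu → Chu
    (x , px) ◁ᶜ (y , py) = (x ◁ᵖ y , ◁-closed x y px py)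

    J : Chu
    J = (Jᵖ , J-in)

{-# OPTIONS --safe #-}
module Submission where

open import Defs
open import Level using (Level)
open import Data.Product using (Σ; _,_)
open import Relation.Binary.PropositionalEquality using (_≡_; cong)
open import Relation.Binary.Core using (_Preserves₂_⟶_⟶_)
open import Relation.Binary.Structures using (IsPreorder; IsPartialOrder)

-- The positive parts of the Chu operations are those of A, so on them every law is inherited.
-- For the negative parts, residuation turns the interchange law for (•, ◁) into its
-- contravariant form (x ⊸ y) ◁ (u ⊸ v) ≤ (x ◁ u) ⊸ (y ◁ v), and monotone ◁ distributes
-- laxly over the meets that make up the negative part of ⊗.

private variable a ℓ : Level

module MeetProperties {A : Set a} {_≤_ : A → A → Set ℓ} (≤-isPreorder : IsPreorder _≡_ _≤_)
                      {_∧_ : A → A → A} (meet : IsMeet _≤_ _∧_) where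
  open IsPreorder ≤-isPreorder using (trans)
  open IsMeet meet

  ∧-mono : _∧_ Preserves₂ _≤_ ⟶ _≤_ ⟶ _≤_
  ∧-mono p≤p′ q≤q′ = greatest (trans (lowerˡ _ _) p≤p′) (trans (lowerʳ _ _) q≤q′)

  mono⇒∧-subdistrib : ∀ {_◁_ : A → A → A} → _◁_ Preserves₂ _≤_ ⟶ _≤_ ⟶ _≤_ →
                      ∀ p q r s → ((p ∧ q) ◁ (r ∧ s)) ≤ ((p ◁ r) ∧ (q ◁ s))
  mono⇒∧-subdistrib ◁-mono p q r s =
    greatest (◁-mono (lowerˡ p q) (lowerˡ r s)) (◁-mono (lowerʳ p q) (lowerʳ r s))

module ResiduationProperties {A : Set a} {_≤_ : A → A → Set ℓ} (≤-isPreorder : IsPreorder _≡_ _≤_)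
                             {_•_ _⊸_ : A → A → A} (residuated : IsResiduated _≤_ _•_ _⊸_) where
  open IsPreorder ≤-isPreorder using (trans) renaming (refl to ≤-refl)
  open IsResiduated residuated

  ⊸-eval : ∀ y z → ((y ⊸ z) • y) ≤ z
  ⊸-eval y z = uncurry ≤-refl

  ◁-⊸-interchange : ∀ {_◁_ : A → A → A} → _◁_ Preserves₂ _≤_ ⟶ _≤_ ⟶ _≤_ →
                    (∀ w x y z → ((w ◁ x) • (y ◁ z)) ≤ ((w • y) ◁ (x • z))) →
                    ∀ x y u v → ((x ⊸ y) ◁ (u ⊸ v)) ≤ ((x ◁ u) ⊸ (y ◁ v))
  ◁-⊸-interchange ◁-mono interchange x y u v =
    curry (trans (interchange (x ⊸ y) (u ⊸ v) x u) (◁-mono (⊸-eval x y) (⊸-eval u v)))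

module ChuDuoidal
  {A : Set a} {_≤_ : A → A → Set ℓ} (≤-isPreorder : IsPreorder _≡_ _≤_)
  {_•_ : A → A → A} {i : A} {_⊸_ _∧_ : A → A → A}
  (•-isPomonoid : IsPomonoid _≤_ _•_ i) (•-comm : IsCommutative _•_)
  (residuated : IsResiduated _≤_ _•_ _⊸_) (meet : IsMeet _≤_ _∧_)
  {k : A} {_◁_ : A → A → A} {j : A}
  (◁-isPomonoid : IsPomonoid _≤_ _◁_ j) (duoidal : IsDuoidal _≤_ _•_ i _◁_ j)
  (k◁k≤k : (k ◁ k) ≤ k) (j≤k : j ≤ k)
  where

  open IsPreorder ≤-isPreorder using (trans; reflexive) renaming (refl to ≤-refl)
  open import Relation.Binary.Reasoning.Base.Double ≤-isPreorder
  module • = IsPomonoid •-isPomonoid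
  module ◁ = IsPomonoid ◁-isPomonoid
  open IsResiduated residuated using (curry; uncurry)
  open IsMeet meet using (lowerˡ; greatest)
  open IsDuoidal duoidal
  open MeetProperties ≤-isPreorder meet
  open ResiduationProperties ≤-isPreorder residuated
  open ChuConstruction _≤_ _•_ _⊸_ _∧_ i k _◁_ j

  InChu-⊗ᵖ : ∀ x y → InChu x → InChu y → InChu (x ⊗ᵖ y)
  InChu-⊗ᵖ (a⁺ , a⁻) (b⁺ , b⁻) a∈Chu _ = begin
    (a⁺ • b⁺) • ((b⁺ ⊸ a⁻) ∧ (a⁺ ⊸ b⁻))   ≡⟨ •.assoc a⁺ b⁺ _ ⟩
    a⁺ • (b⁺ • ((b⁺ ⊸ a⁻) ∧ (a⁺ ⊸ b⁻)))   ≡⟨ cong (a⁺ •_) (•-comm b⁺ _) ⟩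
    a⁺ • (((b⁺ ⊸ a⁻) ∧ (a⁺ ⊸ b⁻)) • b⁺)   ≲⟨ •.mono ≤-refl (uncurry (lowerˡ _ _)) ⟩
    a⁺ • a⁻                               ≲⟨ a∈Chu ⟩
    k                                     ∎

  InChu-Iᵖ : InChu Iᵖ
  InChu-Iᵖ = reflexive (•.identityˡ k)

  InChu-◁ᵖ : ∀ x y → InChu x → InChu y → InChu (x ◁ᵖ y)
  InChu-◁ᵖ (a⁺ , a⁻) (b⁺ , b⁻) a∈Chu b∈Chu = begin
    (a⁺ ◁ b⁺) • (a⁻ ◁ b⁻)   ≲⟨ interchange a⁺ b⁺ a⁻ b⁻ ⟩
    (a⁺ • a⁻) ◁ (b⁺ • b⁻)   ≲⟨ ◁.mono a∈Chu b∈Chu ⟩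
    k ◁ k                   ≲⟨ k◁k≤k ⟩
    k                       ∎

  InChu-Jᵖ : InChu Jᵖ
  InChu-Jᵖ = trans j·j≤j j≤k

  open OnChu InChu-⊗ᵖ InChu-Iᵖ InChu-◁ᵖ InChu-Jᵖ

  ⊗-◁-interchange : ∀ w x y z → ((w ◁ᶜ x) ⊗ (y ◁ᶜ z)) ⊑ ((w ⊗ y) ◁ᶜ (x ⊗ z))
  ⊗-◁-interchange ((w⁺ , w⁻) , _) ((x⁺ , x⁻) , _) ((y⁺ , y⁻) , _) ((z⁺ , z⁻) , _) =
    interchange w⁺ x⁺ y⁺ z⁺ , (begin
      ((y⁺ ⊸ w⁻) ∧ (w⁺ ⊸ y⁻)) ◁ ((z⁺ ⊸ x⁻) ∧ (x⁺ ⊸ z⁻))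
        ≲⟨ mono⇒∧-subdistrib ◁.mono _ _ _ _ ⟩
      ((y⁺ ⊸ w⁻) ◁ (z⁺ ⊸ x⁻)) ∧ ((w⁺ ⊸ y⁻) ◁ (x⁺ ⊸ z⁻))
        ≲⟨ ∧-mono (◁-⊸-interchange ◁.mono interchange y⁺ w⁻ z⁺ x⁻)
                  (◁-⊸-interchange ◁.mono interchange w⁺ y⁻ x⁺ z⁻) ⟩
      ((y⁺ ◁ z⁺) ⊸ (w⁻ ◁ x⁻)) ∧ ((w⁺ ◁ x⁺) ⊸ (y⁻ ◁ z⁻))
        ∎)

  ⊗-◁-isDuoidal : IsDuoidal _⊑_ _⊗_ I _◁ᶜ_ J
  ⊗-◁-isDuoidal = record
    { interchange = ⊗-◁-interchange
    ; j·j≤j       = j·j≤j , greatest j≤j⊸j j≤j⊸j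
    ; i≤i◁i       = i≤i◁i , k◁k≤k
    ; i≤j         = i≤j , j≤k
    }
    where
    j≤j⊸j : j ≤ (j ⊸ j)
    j≤j⊸j = curry j·j≤j

proposition3p47 : {a ℓ : Level} (A : Set a) (_≤_ : A → A → Set ℓ)
    → IsPartialOrder _≡_ _≤_
    → (_•_ : A → A → A) (i : A) (_⊸_ : A → A → A) (_∧_ : A → A → A)
    → IsPomonoid _≤_ _•_ i → IsCommutative _•_ → IsResiduated _≤_ _•_ _⊸_ → IsMeet _≤_ _∧_
    → (k : A) (_◁_ : A → A → A) (j : A)
    → IsPomonoid _≤_ _◁_ j → IsDuoidal _≤_ _•_ i _◁_ j
    → (k ◁ k) ≤ k → j ≤ k
    → let open ChuConstruction _≤_ _•_ _⊸_ _∧_ i k _◁_ j in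
      Σ (∀ x y → InChu x → InChu y → InChu (x ⊗ᵖ y)) λ ⊗-closed →
      Σ (InChu Iᵖ) λ I-in →
      Σ (∀ x y → InChu x → InChu y → InChu (x ◁ᵖ y)) λ ◁-closed →
      Σ (InChu Jᵖ) λ J-in →
      IsDuoidal _⊑_ (OnChu._⊗_ ⊗-closed I-in ◁-closed J-in) (OnChu.I ⊗-closed I-in ◁-closed J-in)
                    (OnChu._◁ᶜ_ ⊗-closed I-in ◁-closed J-in) (OnChu.J ⊗-closed I-in ◁-closed J-in)
proposition3p47 A _≤_ ≤-isPartialOrder _•_ i _⊸_ _∧_ •-isPomonoid •-comm residuated meet
                k _◁_ j ◁-isPomonoid duoidal k◁k≤k j≤k =
  InChu-⊗ᵖ , InChu-Iᵖ , InChu-◁ᵖ , InChu-Jᵖ , ⊗-◁-isDuoidal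
  where
  open ChuDuoidal (IsPartialOrder.isPreorder ≤-isPartialOrder) •-isPomonoid •-comm residuated meet
                  ◁-isPomonoid duoidal k◁k≤k j≤k
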